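{- For all $n \geq 0$, $$\overline{p}(n)+\sum_{j\ge1}(-1)^j\Big(\overline{p}\big(n-j(3j-1)\big)+\overline{p}\big(n-j(3j+1)\big)\Big) = \overline{p}(n)-\overline{p}(n-2)-\overline{p}(n-4)+\overline{p}(n-10)+\overline{p}(n-14)-\cdots = \overline{p_d}(n).$$
   Context: An overpartition of $n$ is a partition of $n$ in which the first occurrence of each distinct part size may be overlined; $\overline{p}(n)$ denotes the number of overpartitions of $n$, with $\overline{p}(0)=1$ and $\overline{p}(m)=0$ for $m<0$; its generating function is $\prod_{k\ge1}\frac{1+q^k}{1-q^k}$. $\overline{p_d}(n)$ denotes the number of overpartitions of $n$ into distinct parts, whose generating function is $\sum_{n\ge0}\overline{p_d}(n)q^n=\prod_{k\ge1}(1+q^k)^2$. -}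

module Defs where

open import Data.Nat using (ℕ; zero; suc; _+_; _*_; _∸_; _≤ᵇ_)
open import Data.Bool using (if_then_else_)
open import Data.Integer as ℤ using (ℤ; +_; -[1+_])

-- Number of ways to choose a multiplicity m ≥ 1 of the part size s
-- (with s * m ≤ n), weighted by 2 (the first occurrence overlined or not),
-- and to complete the remaining n ∸ s*m by the counting function f.
-- `fuel` bounds the multiplicity; using fuel = n suffices since s ≥ 1.
multSum : (f : ℕ → ℕ) (s : ℕ) (n : ℕ) (fuel : ℕ) → ℕ
multSum f s n zero = 0
multSum f s n (suc m) =
  multSum f s n m + (if s * suc m ≤ᵇ n then 2 * f (n ∸ s * suc m) else 0)

-- opCount k n = number of overpartitions of n all of whose parts are ≤ k.
-- An overpartition is determined by the multiplicity of each part size and,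
-- for each part size that occurs, whether its first occurrence is overlined.
opCount : ℕ → ℕ → ℕ
opCount zero zero = 1
opCount zero (suc n) = 0
opCount (suc k) n = opCount k n + multSum (opCount k) (suc k) n n

pbar : ℕ → ℕ
pbar n = opCount n n

pbarℤ : ℤ → ℕ
pbarℤ (+ n) = pbar n
pbarℤ -[1+ n ] = 0

-- pdCount k n = number of overpartitions of n into distinct parts,
-- all parts ≤ k.  "Distinct" means no two equal parts (overlined and
-- non-overlined versions of a size count as different parts), so each size s
-- occurs as: absent, s alone, s̄ alone, or both s̄ and s; this matches the
-- generating function ∏ (1 + q^k)^2.
pdCount : ℕ → ℕ → ℕ
pdCount zero zero = 1
pdCount zero (suc n) = 0
pdCount (suc k) n =
  pdCount k n + (if suc k ≤ᵇ n then 2 * pdCount k (n ∸ suc k) else 0)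
              + (if 2 * suc k ≤ᵇ n then pdCount k (n ∸ 2 * suc k) else 0)

pbard : ℕ → ℕ
pbard n = pdCount n n

sumFrom1 : (ℕ → ℤ) → ℕ → ℤ
sumFrom1 f zero = + 0
sumFrom1 f (suc J) = sumFrom1 f J ℤ.+ f (suc J)

sgn : ℕ → ℤ
sgn zero = + 1
sgn (suc j) = ℤ.- sgn j

term : ℕ → ℕ → ℤ
term n j = sgn j ℤ.* (+ pbarℤ (+ n ℤ.- + (j * (3 * j ∸ 1)))
                        ℤ.+ + pbarℤ (+ n ℤ.- + (j * (3 * j + 1))))

module Submission where

-- Write P̄(q) = ∏ (1+q^k)/(1-q^k) for the overpartition generating function.
-- Then ∏ (1-q^{2k}) · P̄(q) = ∏ (1+q^k)², the generating function of p̄_d,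
-- and by Euler's pentagonal theorem (in q²) the left factor is
-- 1 + Σ_{j≥1} (-1)^j (q^{j(3j-1)} + q^{j(3j+1)}).  Comparing coefficients of
-- q^n gives the theorem.  Everything is done with truncations, so no formal
-- power series are needed: an integer sequence G : ℤ → ℤ stands for Σ G(n) q^n,
-- and multiplication by 1 ∓ q^a becomes the operator G ↦ G(z) ∓ G(z - a).

open import Defs
open import Data.Nat using (ℕ; _≤_)
open import Data.Integer using (ℤ; +_; _+_)
open import Relation.Binary.PropositionalEquality using (_≡_)

open import Data.Nat as ℕ using (zero; suc; _∸_; _<_; z≤n; s≤s; _≤ᵇ_)
import Data.Nat.Properties as ℕP
import Data.Nat.Tactic.RingSolver as ℕSolver
open import Data.Integer using (-[1+_]; _-_; _*_; -_)
import Data.Integer as ℤ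
import Data.Integer.Properties as ℤP
open import Data.Integer.Tactic.RingSolver using (solve-∀)
open import Data.Bool using (true; false; if_then_else_)
open import Data.Empty using (⊥-elim)
open import Data.Sum using (inj₁; inj₂)
open import Relation.Nullary using (yes; no)
open import Relation.Nullary.Reflects using (ofʸ; ofⁿ; fromEquivalence; det)
open import Relation.Binary.PropositionalEquality
  using (refl; sym; trans; cong; cong₂; subst; module ≡-Reasoning)

open ≡-Reasoning

shift-shift : ∀ z a b → z - + a - + b ≡ z - + (a ℕ.+ b)
shift-shift z a b = trans (assoc z (+ a) (+ b)) (cong (λ k → z - k) (sym (ℤP.pos-+ a b)))
  where
  assoc : ∀ (z x y : ℤ) → z - x - y ≡ z - (x + y)
  assoc = solve-∀

shift-comm : ∀ z a b → z - + a - + b ≡ z - + b - + a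
shift-comm z a b =
  trans (shift-shift z a b) (trans (cong (λ k → z - + k) (ℕP.+-comm a b)) (sym (shift-shift z b a)))

-- Shifting by a + a is shifting twice by a (note 2 * a unfolds to a + (a + 0)).
shift-double : ∀ z a → z - + (2 ℕ.* a) ≡ z - + a - + a
shift-double z a = trans (cong (λ k → z - + (a ℕ.+ k)) (ℕP.+-identityʳ a)) (sym (shift-shift z a a))

shift-zero : ∀ z → z - + 0 ≡ z
shift-zero = ℤP.+-identityʳ

shift-cancel : ∀ a r → + (a ℕ.+ r) - + a ≡ + r
shift-cancel a r = trans (cong (_- + a) (ℤP.pos-+ a r)) (cancel (+ a) (+ r))
  where
  cancel : ∀ (x y : ℤ) → x + y - x ≡ y
  cancel = solve-∀

shift-≥ : ∀ {n a} → a ≤ n → + n - + a ≡ + (n ∸ a)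
shift-≥ {n} {a} a≤n = trans (ℤP.m-n≡m⊖n n a) (ℤP.⊖-≥ a≤n)

shift-< : ∀ {n a} → n < a → + n - + a ℤ.< + 0
shift-< {n} {a} n<a rewrite ℤP.m-n≡m⊖n n a | ℤP.⊖-< n<a with a ∸ n | ℕP.m<n⇒0<n∸m n<a
... | suc k | _ = ℤ.-<+

shift-pres-< : ∀ {z b} a → z ℤ.< b → z - + a ℤ.< b
shift-pres-< {z} a z<b = ℤP.≤-<-trans (ℤP.i-j≤i z (+ a)) z<b

shift-pres-≤ : ∀ {z b} a → z ℤ.≤ b → z - + a ℤ.≤ b
shift-pres-≤ {z} a z≤b = ℤP.≤-trans (ℤP.i-j≤i z (+ a)) z≤b

-- A sequence G stands for the series Σ G(z) q^z.
Seq : Set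
Seq = ℤ → ℤ

oneMinus : ℕ → Seq → Seq
oneMinus a G z = G z - G (z - + a)

onePlus : ℕ → Seq → Seq
onePlus a G z = G z + G (z - + a)

onePlus-cong : ∀ a {G H : Seq} → (∀ w → G w ≡ H w) → ∀ z → onePlus a G z ≡ onePlus a H z
onePlus-cong a G≡H z = cong₂ _+_ (G≡H z) (G≡H (z - + a))

oneMinus-double : ∀ a G z → oneMinus (2 ℕ.* a) G z ≡ onePlus a (oneMinus a G) z
oneMinus-double a G z =
  trans (cong (λ w → G z - G w) (shift-double z a))
        (telescope (G z) (G (z - + a)) (G (z - + a - + a)))
  where
  telescope : ∀ (x y t : ℤ) → x - t ≡ (x - y) + (y - t)
  telescope = solve-∀

seqOf : (ℕ → ℕ) → Seq
seqOf f (+ n)    = + f n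
seqOf f -[1+ n ] = + 0

seqOf-neg : ∀ f {z} → z ℤ.< + 0 → seqOf f z ≡ + 0
seqOf-neg f {+ n} (ℤ.+<+ ())
seqOf-neg f { -[1+ n ]} _ = refl

seqOf-below : ∀ f {n a} → n < a → seqOf f (+ n - + a) ≡ + 0
seqOf-below f n<a = seqOf-neg f (shift-< n<a)

seqOf-+ : ∀ f g z → seqOf (λ n → f n ℕ.+ g n) z ≡ seqOf f z + seqOf g z
seqOf-+ f g (+ n)    = ℤP.pos-+ (f n) (g n)
seqOf-+ f g -[1+ n ] = refl

seqOf-double : ∀ f z → seqOf (λ n → 2 ℕ.* f n) z ≡ seqOf f z + seqOf f z
seqOf-double f (+ n)    = trans (cong (λ k → + (f n ℕ.+ k)) (ℕP.+-identityʳ (f n))) (ℤP.pos-+ (f n) (f n))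
seqOf-double f -[1+ n ] = refl

guard-seqOf : ∀ g a n → + (if a ≤ᵇ n then g (n ∸ a) else 0) ≡ seqOf g (+ n - + a)
guard-seqOf g a n with a ≤ᵇ n | ℕP.≤ᵇ-reflects-≤ a n
... | true  | ofʸ a≤n = sym (cong (seqOf g) (shift-≥ a≤n))
... | false | ofⁿ a≰n = sym (seqOf-below g (ℕP.≰⇒> a≰n))

guard-fails : ∀ {a n} (x : ℕ) → n < a → (if a ≤ᵇ n then x else 0) ≡ 0
guard-fails {a} {n} x n<a with a ≤ᵇ n | ℕP.≤ᵇ-reflects-≤ a n
... | true  | ofʸ a≤n = ⊥-elim (ℕP.<⇒≱ n<a a≤n)
... | false | _       = refl

guard-holds : ∀ {a n} (x : ℕ) → a ≤ n → (if a ≤ᵇ n then x else 0) ≡ x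
guard-holds {a} {n} x a≤n with a ≤ᵇ n | ℕP.≤ᵇ-reflects-≤ a n
... | true  | _       = refl
... | false | ofⁿ a≰n = ⊥-elim (a≰n a≤n)

≤ᵇ-+ˡ : ∀ s x r → (s ℕ.+ x ≤ᵇ s ℕ.+ r) ≡ (x ≤ᵇ r)
≤ᵇ-+ˡ s x r = det
  (fromEquivalence (λ t → ℕP.+-cancelˡ-≤ s x r (ℕP.≤ᵇ⇒≤ _ _ t)) (λ h → ℕP.≤⇒≤ᵇ (ℕP.+-monoʳ-≤ s h)))
  (ℕP.≤ᵇ-reflects-≤ x r)

-- multSum f s n F with enough fuel counts, with weight 2 for the overlining of
-- the first occurrence, the ways to use s at least once and fill the rest by f:
-- as a series it is (2q^s + 2q^{2s} + ⋯) · Σ f(m) q^m.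
multSum-skip : ∀ f s n m → n < s ℕ.* suc m → multSum f s n (suc m) ≡ multSum f s n m
multSum-skip f s n m n<sm = trans (cong (multSum f s n m ℕ.+_) (guard-fails _ n<sm)) (ℕP.+-identityʳ _)

multSum-small : ∀ f N n fuel → n < suc N → multSum f (suc N) n fuel ≡ 0
multSum-small f N n zero    n<s = refl
multSum-small f N n (suc m) n<s =
  trans (multSum-skip f (suc N) n m (ℕP.<-≤-trans n<s (ℕP.m≤m*n (suc N) (suc m))))
        (multSum-small f N n m n<s)

multSum-fuel : ∀ f N n k → multSum f (suc N) n (n ℕ.+ k) ≡ multSum f (suc N) n n
multSum-fuel f N n zero    rewrite ℕP.+-identityʳ n = refl
multSum-fuel f N n (suc k) rewrite ℕP.+-suc n k =
  trans (multSum-skip f (suc N) n (n ℕ.+ k)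
          (ℕP.<-≤-trans (s≤s (ℕP.m≤m+n n k)) (ℕP.m≤n*m (suc (n ℕ.+ k)) (suc N))))
        (multSum-fuel f N n k)

multSum-shift : ∀ f s r F → multSum f s (s ℕ.+ r) (suc F) ≡ 2 ℕ.* f r ℕ.+ multSum f s r F
multSum-shift f s r zero
  rewrite ℕP.*-identityʳ s | guard-holds (2 ℕ.* f (s ℕ.+ r ∸ s)) (ℕP.m≤m+n s r) | ℕP.m+n∸m≡n s r
  = sym (ℕP.+-identityʳ (2 ℕ.* f r))
multSum-shift f s r (suc F)
  rewrite multSum-shift f s r F | ℕP.*-suc s (suc F)
        | ℕP.[m+n]∸[m+o]≡n∸o s r (s ℕ.* suc F) | ≤ᵇ-+ˡ s (s ℕ.* suc F) r
  = ℕP.+-assoc (2 ℕ.* f r) (multSum f s r F) _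

multTotal : (ℕ → ℕ) → ℕ → ℕ → ℕ
multTotal f s n = multSum f s n n

-- Position of an integer relative to a positive shift a: the three cases in
-- which the coefficient recursion for a part size a behaves differently.
data Position (a : ℕ) : ℤ → Set where
  negative : ∀ k → Position a -[1+ k ]
  small    : ∀ {n} → n < a → Position a (+ n)
  large    : ∀ r → Position a (+ (a ℕ.+ r))

position : ∀ a z → Position a z
position a -[1+ k ] = negative k
position a (+ n) with a ℕ.≤? n
... | yes a≤n = subst (Position a) (cong +_ (ℕP.m+[n∸m]≡n a≤n)) (large (n ∸ a))
... | no  a≰n = small (ℕP.≰⇒> a≰n)

multTotal-rec : ∀ f N z →
  seqOf (multTotal f (suc N)) z
    ≡ (seqOf f (z - + suc N) + seqOf f (z - + suc N)) + seqOf (multTotal f (suc N)) (z - + suc N)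
multTotal-rec f N z with position (suc N) z
... | negative k
  rewrite seqOf-neg f (shift-pres-< (suc N) (ℤ.-<+ {k} {0}))
        | seqOf-neg (multTotal f (suc N)) (shift-pres-< (suc N) (ℤ.-<+ {k} {0})) = refl
... | small {n} n<s
  rewrite multSum-small f N n n n<s
        | seqOf-below f n<s | seqOf-below (multTotal f (suc N)) n<s = refl
... | large r rewrite shift-cancel (suc N) r = begin
  + multSum f (suc N) (suc N ℕ.+ r) (suc (N ℕ.+ r))
    ≡⟨ cong +_ (multSum-shift f (suc N) r (N ℕ.+ r)) ⟩
  + (2 ℕ.* f r ℕ.+ multSum f (suc N) r (N ℕ.+ r))
    ≡⟨ cong (λ k → + (2 ℕ.* f r ℕ.+ multSum f (suc N) r k)) (ℕP.+-comm N r) ⟩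
  + (2 ℕ.* f r ℕ.+ multSum f (suc N) r (r ℕ.+ N))
    ≡⟨ cong (λ k → + (2 ℕ.* f r ℕ.+ k)) (multSum-fuel f N r N) ⟩
  + (2 ℕ.* f r ℕ.+ multTotal f (suc N) r)
    ≡⟨ ℤP.pos-+ (2 ℕ.* f r) (multTotal f (suc N) r) ⟩
  + (2 ℕ.* f r) + + multTotal f (suc N) r
    ≡⟨ cong (_+ + multTotal f (suc N) r) (seqOf-double f (+ r)) ⟩
  (+ f r + + f r) + + multTotal f (suc N) r ∎

-- overpartitions with parts ≤ N, i.e. ∏_{k≤N} (1+q^k)/(1-q^k)
opSeq : ℕ → Seq
opSeq N = seqOf (opCount N)

-- overpartitions into distinct parts ≤ N, i.e. ∏_{k≤N} (1+q^k)²
pdSeq : ℕ → Seq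
pdSeq N = seqOf (pdCount N)

overpartition-rec : ∀ N z → oneMinus (suc N) (opSeq (suc N)) z ≡ onePlus (suc N) (opSeq N) z
overpartition-rec N z = begin
  opSeq (suc N) z - opSeq (suc N) w
    ≡⟨ cong₂ _-_ (seqOf-+ (opCount N) M z) (seqOf-+ (opCount N) M w) ⟩
  (opSeq N z + seqOf M z) - (opSeq N w + seqOf M w)
    ≡⟨ cong (λ t → (opSeq N z + t) - (opSeq N w + seqOf M w)) (multTotal-rec (opCount N) N z) ⟩
  (opSeq N z + ((opSeq N w + opSeq N w) + seqOf M w)) - (opSeq N w + seqOf M w)
    ≡⟨ cancel (opSeq N z) (opSeq N w) (seqOf M w) ⟩
  opSeq N z + opSeq N w ∎
  where
  w = z - + suc N
  M = multTotal (opCount N) (suc N)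
  cancel : ∀ (x y m : ℤ) → (x + ((y + y) + m)) - (y + m) ≡ x + y
  cancel = solve-∀

distinct-rec : ∀ N z → pdSeq (suc N) z ≡ onePlus (suc N) (onePlus (suc N) (pdSeq N)) z
distinct-rec N -[1+ k ]
  rewrite seqOf-neg (pdCount N) (shift-pres-< (suc N) (ℤ.-<+ {k} {0}))
        | seqOf-neg (pdCount N) (shift-pres-< (suc N) (shift-pres-< (suc N) (ℤ.-<+ {k} {0}))) = refl
distinct-rec N (+ n) = begin
  + (pdCount N n ℕ.+ twice ℕ.+ both)
    ≡⟨ trans (ℤP.pos-+ (pdCount N n ℕ.+ twice) both) (cong (_+ + both) (ℤP.pos-+ (pdCount N n) twice)) ⟩
  (K (+ n) + + twice) + + both
    ≡⟨ cong₂ (λ t u → (K (+ n) + t) + u) (guard-seqOf (λ m → 2 ℕ.* pdCount N m) (suc N) n)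
                                           (guard-seqOf (pdCount N) (2 ℕ.* suc N) n) ⟩
  (K (+ n) + seqOf (λ m → 2 ℕ.* pdCount N m) w) + K (+ n - + (2 ℕ.* suc N))
    ≡⟨ cong₂ (λ t u → (K (+ n) + t) + K u) (seqOf-double (pdCount N) w) (shift-double (+ n) (suc N)) ⟩
  (K (+ n) + (K w + K w)) + K (w - + suc N)
    ≡⟨ regroup (K (+ n)) (K w) (K (w - + suc N)) ⟩
  (K (+ n) + K w) + (K w + K (w - + suc N)) ∎
  where
  K = pdSeq N
  w = + n - + suc N
  twice = if suc N ≤ᵇ n then 2 ℕ.* pdCount N (n ∸ suc N) else 0
  both  = if 2 ℕ.* suc N ≤ᵇ n then pdCount N (n ∸ 2 ℕ.* suc N) else 0
  regroup : ∀ (x y t : ℤ) → (x + (y + y)) + t ≡ (x + y) + (y + t)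
  regroup = solve-∀

opCount-stable : ∀ k n → n ≤ k → opCount k n ≡ opCount n n
opCount-stable zero    .zero z≤n = refl
opCount-stable (suc k) n n≤k with ℕP.m≤n⇒m<n∨m≡n n≤k
... | inj₂ refl = refl
... | inj₁ n<k  = trans (cong (opCount k n ℕ.+_) (multSum-small (opCount k) k n n n<k))
                        (trans (ℕP.+-identityʳ _) (opCount-stable k n (ℕP.≤-pred n<k)))

pdCount-stable : ∀ k n → n ≤ k → pdCount k n ≡ pdCount n n
pdCount-stable zero    .zero z≤n = refl
pdCount-stable (suc k) n n≤k with ℕP.m≤n⇒m<n∨m≡n n≤k
... | inj₂ refl = refl
... | inj₁ n<k
  rewrite guard-fails (2 ℕ.* pdCount k (n ∸ suc k)) n<k
        | guard-fails (pdCount k (n ∸ 2 ℕ.* suc k)) (ℕP.<-≤-trans n<k (ℕP.m≤n*m (suc k) 2))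
  = trans (ℕP.+-identityʳ _) (trans (ℕP.+-identityʳ _) (pdCount-stable k n (ℕP.≤-pred n<k)))

+-−-interchange : ∀ (a b c d : ℤ) → (a + b) - (c + d) ≡ (a - c) + (b - d)
+-−-interchange = solve-∀

−-−-interchange : ∀ (a b c d : ℤ) → (a - b) - (c - d) ≡ (a - c) - (b - d)
−-−-interchange = solve-∀

-- prodOp j d F = ∏_{k=j+1}^{j+d} (1 - q^{2k}) F, the factor k = j+1 outermost
prodOp : ℕ → ℕ → Seq → Seq
prodOp j zero    F = F
prodOp j (suc d) F = oneMinus (2 ℕ.* suc j) (prodOp (suc j) d F)

prodOp-+ : ∀ j d G H z → prodOp j d (λ w → G w + H w) z ≡ prodOp j d G z + prodOp j d H z
prodOp-+ j zero    G H z = refl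
prodOp-+ j (suc d) G H z
  rewrite prodOp-+ (suc j) d G H z | prodOp-+ (suc j) d G H (z - + (2 ℕ.* suc j))
  = +-−-interchange (prodOp (suc j) d G z) (prodOp (suc j) d H z) _ _

prodOp-- : ∀ j d G H z → prodOp j d (λ w → G w - H w) z ≡ prodOp j d G z - prodOp j d H z
prodOp-- j zero    G H z = refl
prodOp-- j (suc d) G H z
  rewrite prodOp-- (suc j) d G H z | prodOp-- (suc j) d G H (z - + (2 ℕ.* suc j))
  = −-−-interchange (prodOp (suc j) d G z) (prodOp (suc j) d H z) _ _

prodOp-shift : ∀ j d G a z → prodOp j d (λ w → G (w - + a)) z ≡ prodOp j d G (z - + a)
prodOp-shift j zero    G a z = refl
prodOp-shift j (suc d) G a z
  rewrite prodOp-shift (suc j) d G a z | prodOp-shift (suc j) d G a (z - + (2 ℕ.* suc j))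
        | shift-comm z a (2 ℕ.* suc j) = refl

prodOp-onePlus : ∀ j d a K z → prodOp j d (onePlus a K) z ≡ onePlus a (prodOp j d K) z
prodOp-onePlus j d a K z =
  trans (prodOp-+ j d K (λ w → K (w - + a)) z) (cong (λ t → prodOp j d K z + t) (prodOp-shift j d K a z))

prodOp-oneMinus : ∀ j d a K z → prodOp j d (oneMinus a K) z ≡ oneMinus a (prodOp j d K) z
prodOp-oneMinus j d a K z =
  trans (prodOp-- j d K (λ w → K (w - + a)) z) (cong (λ t → prodOp j d K z - t) (prodOp-shift j d K a z))

prodOp-ext : ∀ j d G H b → (∀ w → w ℤ.≤ b → G w ≡ H w) → ∀ z → z ℤ.≤ b → prodOp j d G z ≡ prodOp j d H z
prodOp-ext j zero    G H b G≡H z z≤b = G≡H z z≤b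
prodOp-ext j (suc d) G H b G≡H z z≤b =
  cong₂ _-_ (prodOp-ext (suc j) d G H b G≡H z z≤b)
            (prodOp-ext (suc j) d G H b G≡H (z - + (2 ℕ.* suc j)) (shift-pres-≤ _ z≤b))

prodOp-neg : ∀ j d F → (∀ z → z ℤ.< + 0 → F z ≡ + 0) → ∀ z → z ℤ.< + 0 → prodOp j d F z ≡ + 0
prodOp-neg j zero    F F-neg z z<0 = F-neg z z<0
prodOp-neg j (suc d) F F-neg z z<0
  rewrite prodOp-neg (suc j) d F F-neg z z<0
        | prodOp-neg (suc j) d F F-neg (z - + (2 ℕ.* suc j)) (shift-pres-< _ z<0) = refl

prodOp-last : ∀ j d F z → prodOp j (suc d) F z ≡ oneMinus (2 ℕ.* suc (j ℕ.+ d)) (prodOp j d F) z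
prodOp-last j zero    F z = cong (λ k → F z - F (z - + (2 ℕ.* suc k))) (sym (ℕP.+-identityʳ j))
prodOp-last j (suc d) F z
  rewrite prodOp-last (suc j) d F z | prodOp-last (suc j) d F (z - + (2 ℕ.* suc j))
        | ℕP.+-suc j d | shift-comm z (2 ℕ.* suc (suc (j ℕ.+ d))) (2 ℕ.* suc j)
  = −-−-interchange (prodOp (suc j) d F z) (prodOp (suc j) d F (z - + (2 ℕ.* suc (suc (j ℕ.+ d))))) _ _

euler-product : ∀ N z → prodOp 0 N (opSeq N) z ≡ pdSeq N z
euler-product zero (+ zero)    = refl
euler-product zero (+ suc n)   = refl
euler-product zero -[1+ k ]   = refl
euler-product (suc N) z = begin
  prodOp 0 (suc N) (opSeq a) z
    ≡⟨ prodOp-last 0 N (opSeq a) z ⟩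
  oneMinus (2 ℕ.* a) (prodOp 0 N (opSeq a)) z
    ≡⟨ sym (prodOp-oneMinus 0 N (2 ℕ.* a) (opSeq a) z) ⟩
  prodOp 0 N (oneMinus (2 ℕ.* a) (opSeq a)) z
    ≡⟨ prodOp-ext 0 N _ _ z factor z ℤP.≤-refl ⟩
  prodOp 0 N (onePlus a (onePlus a (opSeq N))) z
    ≡⟨ prodOp-onePlus 0 N a (onePlus a (opSeq N)) z ⟩
  onePlus a (prodOp 0 N (onePlus a (opSeq N))) z
    ≡⟨ onePlus-cong a (prodOp-onePlus 0 N a (opSeq N)) z ⟩
  onePlus a (onePlus a (prodOp 0 N (opSeq N))) z
    ≡⟨ onePlus-cong a (onePlus-cong a (euler-product N)) z ⟩
  onePlus a (onePlus a (pdSeq N)) z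
    ≡⟨ sym (distinct-rec N z) ⟩
  pdSeq a z ∎
  where
  a = suc N
  -- (1 - q^{2a}) P̄_{≤a} = (1 + q^a)(1 - q^a) P̄_{≤a} = (1 + q^a)² P̄_{≤a-1}
  factor : ∀ w → w ℤ.≤ z → oneMinus (2 ℕ.* a) (opSeq a) w ≡ onePlus a (onePlus a (opSeq N)) w
  factor w _ = trans (oneMinus-double a (opSeq a) w) (onePlus-cong a (overpartition-rec N) w)

Σ₀ : (ℕ → ℤ) → ℕ → ℤ
Σ₀ g zero    = g 0
Σ₀ g (suc m) = Σ₀ g m + g (suc m)

Σ₀-cong : ∀ f g m → (∀ j → j ≤ m → f j ≡ g j) → Σ₀ f m ≡ Σ₀ g m
Σ₀-cong f g zero    f≡g = f≡g 0 z≤n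
Σ₀-cong f g (suc m) f≡g =
  cong₂ _+_ (Σ₀-cong f g m (λ j j≤m → f≡g j (ℕP.m≤n⇒m≤1+n j≤m))) (f≡g (suc m) ℕP.≤-refl)

Σ₀-telescope : ∀ (b c : ℕ → ℤ) m → Σ₀ (λ j → b j + (c (suc j) - c j)) m ≡ Σ₀ b m + (c (suc m) - c 0)
Σ₀-telescope b c zero    = refl
Σ₀-telescope b c (suc m) rewrite Σ₀-telescope b c m =
  regroup (Σ₀ b m) (c (suc m)) (c 0) (b (suc m)) (c (suc (suc m)))
  where
  regroup : ∀ (B C₁ C₀ b C₂ : ℤ) → (B + (C₁ - C₀)) + (b + (C₂ - C₁)) ≡ (B + b) + (C₂ - C₀)
  regroup = solve-∀

Σ₀-head : ∀ g m → (∀ i → suc i ≤ m → g (suc i) ≡ + 0) → Σ₀ g m ≡ g 0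
Σ₀-head g zero    _    = refl
Σ₀-head g (suc m) tail
  rewrite Σ₀-head g m (λ i i<m → tail i (ℕP.m≤n⇒m≤1+n i<m)) | tail m ℕP.≤-refl = ℤP.+-identityʳ (g 0)

-- exponents of Shanks' identity (in q²): shanksExp m j = j(2m + j + 1)
shanksExp : ℕ → ℕ → ℕ
shanksExp m j = j ℕ.* (2 ℕ.* m ℕ.+ j ℕ.+ 1)

shanksExp-step : ∀ m j → shanksExp (suc m) j ≡ shanksExp m j ℕ.+ 2 ℕ.* j
shanksExp-step = polynomial
  where
  polynomial : ∀ m j → j ℕ.* (2 ℕ.* suc m ℕ.+ j ℕ.+ 1) ≡ j ℕ.* (2 ℕ.* m ℕ.+ j ℕ.+ 1) ℕ.+ 2 ℕ.* j
  polynomial = ℕSolver.solve-∀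

shanksExp-next : ∀ m j → shanksExp (suc m) j ℕ.+ 2 ℕ.* suc m ≡ shanksExp m (suc j)
shanksExp-next = polynomial
  where
  polynomial : ∀ m j → j ℕ.* (2 ℕ.* suc m ℕ.+ j ℕ.+ 1) ℕ.+ 2 ℕ.* suc m ≡ suc j ℕ.* (2 ℕ.* m ℕ.+ suc j ℕ.+ 1)
  polynomial = ℕSolver.solve-∀

shanksExp-pent⁻ : ∀ m → shanksExp m (suc m) ≡ suc m ℕ.* (3 ℕ.* suc m ∸ 1)
shanksExp-pent⁻ m = trans (polynomial m) (cong (λ k → suc m ℕ.* (k ∸ 1)) (sym (ℕP.*-suc 3 m)))
  where
  polynomial : ∀ m → suc m ℕ.* (2 ℕ.* m ℕ.+ suc m ℕ.+ 1) ≡ suc m ℕ.* (2 ℕ.+ 3 ℕ.* m)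
  polynomial = ℕSolver.solve-∀

shanksExp-pent⁺ : ∀ m → shanksExp (suc m) (suc m) ≡ suc m ℕ.* (3 ℕ.* suc m ℕ.+ 1)
shanksExp-pent⁺ = polynomial
  where
  polynomial : ∀ m → suc m ℕ.* (2 ℕ.* suc m ℕ.+ suc m ℕ.+ 1) ≡ suc m ℕ.* (3 ℕ.* suc m ℕ.+ 1)
  polynomial = ℕSolver.solve-∀

shanksExp-large : ∀ m i → m < shanksExp m (suc i)
shanksExp-large m i = subst (suc m ≤_) (sym (polynomial m i)) (ℕP.m≤m+n (suc m) _)
  where
  polynomial : ∀ m i → suc i ℕ.* (2 ℕ.* m ℕ.+ suc i ℕ.+ 1)
                       ≡ suc m ℕ.+ (m ℕ.+ suc i ℕ.+ i ℕ.* (2 ℕ.* m ℕ.+ suc i ℕ.+ 1))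
  polynomial = ℕSolver.solve-∀

-- Shanks' finite pentagonal identity, for any family A m j of series that
-- behaves like A m j = ∏_{k=j+1}^{m} (1 - q^{2k}) F:
--   Σ_{j=0}^{m} (-1)^j q^{shanksExp m j} A m j
--     = F + Σ_{j=1}^{m} (-1)^j (q^{j(3j-1)} + q^{j(3j+1)}) F.
-- Proof by induction on m: the terms for m+1 and for m differ by a telescoping
-- correction, and the last term and the telescoped boundary are pentagonal.
module Shanks (F : Seq) (A : ℕ → ℕ → Seq)
  (A-top  : ∀ m j → j ≤ m → ∀ w → A (suc m) j w ≡ oneMinus (2 ℕ.* suc m) (A m j) w)
  (A-step : ∀ m i → suc i ≤ m → ∀ w → A m i w ≡ oneMinus (2 ℕ.* suc i) (A m (suc i)) w)
  (A-diag : ∀ m w → A m m w ≡ F w) where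

  shanksTerm : ℕ → ℤ → ℕ → ℤ
  shanksTerm m z j = sgn j * A m j (z - + shanksExp m j)

  shanksSum : ℕ → ℤ → ℤ
  shanksSum m z = Σ₀ (shanksTerm m z) m

  pentTerm : ℤ → ℕ → ℤ
  pentTerm z j = sgn j * (F (z - + (j ℕ.* (3 ℕ.* j ∸ 1))) + F (z - + (j ℕ.* (3 ℕ.* j ℕ.+ 1))))

  pentSum : ℕ → ℤ → ℤ
  pentSum m z = F z + sumFrom1 (pentTerm z) m

  -- the telescoping correction between the sums for m and m+1
  correction : ℕ → ℤ → ℕ → ℤ
  correction m z zero    = + 0
  correction m z (suc i) = sgn (suc i) * A m i (z - + shanksExp m (suc i))

  shift-step : ∀ m j z → z - + shanksExp (suc m) j ≡ z - + shanksExp m j - + (2 ℕ.* j)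
  shift-step m j z = trans (cong (λ k → z - + k) (shanksExp-step m j)) (sym (shift-shift z _ _))

  shift-next : ∀ m j z → z - + shanksExp (suc m) j - + (2 ℕ.* suc m) ≡ z - + shanksExp m (suc j)
  shift-next m j z = trans (shift-shift z _ _) (cong (λ k → z - + k) (shanksExp-next m j))

  term-step : ∀ m z j → j ≤ m →
    shanksTerm (suc m) z j ≡ shanksTerm m z j + (correction m z (suc j) - correction m z j)
  term-step m z zero _ = begin
    s * A (suc m) 0 (z - + 0)
      ≡⟨ cong (s *_) (A-top m 0 z≤n (z - + 0)) ⟩
    s * (A m 0 (z - + 0) - A m 0 (z - + 0 - + (2 ℕ.* suc m)))
      ≡⟨ cong (λ t → s * (A m 0 (z - + 0) - A m 0 t)) (shift-next m 0 z) ⟩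
    s * (A m 0 (z - + 0) - A m 0 (z - + shanksExp m 1))
      ≡⟨ distribute s (A m 0 (z - + 0)) (A m 0 (z - + shanksExp m 1)) ⟩
    s * A m 0 (z - + 0) + ((- s) * A m 0 (z - + shanksExp m 1) - + 0) ∎
    where
    s = sgn 0
    distribute : ∀ (s p q : ℤ) → s * (p - q) ≡ s * p + ((- s) * q - + 0)
    distribute = solve-∀
  term-step m z (suc i) i<m = begin
    s * A (suc m) j (z - + shanksExp (suc m) j)
      ≡⟨ cong (s *_) (A-top m j i<m _) ⟩
    s * (A m j (z - + shanksExp (suc m) j) - A m j (z - + shanksExp (suc m) j - + (2 ℕ.* suc m)))
      ≡⟨ cong₂ (λ t u → s * (A m j t - A m j u)) (shift-step m j z) (shift-next m j z) ⟩
    s * (A m j (w - + (2 ℕ.* j)) - A m j (z - + shanksExp m (suc j)))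
      ≡⟨ distribute s (A m j (w - + (2 ℕ.* j))) (A m j (z - + shanksExp m (suc j))) (A m j w) ⟩
    s * A m j w + ((- s) * A m j (z - + shanksExp m (suc j)) - s * oneMinus (2 ℕ.* j) (A m j) w)
      ≡⟨ cong (λ t → s * A m j w + ((- s) * A m j (z - + shanksExp m (suc j)) - s * t))
              (sym (A-step m i i<m w)) ⟩
    s * A m j w + ((- s) * A m j (z - + shanksExp m (suc j)) - s * A m i w) ∎
    where
    j = suc i
    s = sgn j
    w = z - + shanksExp m j
    distribute : ∀ (s p q r : ℤ) → s * (p - q) ≡ s * r + ((- s) * q - s * (r - p))
    distribute = solve-∀

  shanks : ∀ m z → shanksSum m z ≡ pentSum m z
  shanks zero z = begin
    sgn 0 * A 0 0 (z - + 0)  ≡⟨ ℤP.*-identityˡ _ ⟩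
    A 0 0 (z - + 0)          ≡⟨ A-diag 0 (z - + 0) ⟩
    F (z - + 0)              ≡⟨ cong F (shift-zero z) ⟩
    F z                      ≡⟨ sym (ℤP.+-identityʳ (F z)) ⟩
    F z + + 0                ∎
  shanks (suc m) z = begin
    Σ₀ (shanksTerm (suc m) z) m + last
      ≡⟨ cong (_+ last) (Σ₀-cong _ _ m (term-step m z)) ⟩
    Σ₀ (λ j → shanksTerm m z j + (correction m z (suc j) - correction m z j)) m + last
      ≡⟨ cong (_+ last) (Σ₀-telescope (shanksTerm m z) (correction m z) m) ⟩
    (shanksSum m z + (correction m z (suc m) - + 0)) + last
      ≡⟨ cong₂ _+_ (cong₂ _+_ (shanks m z) boundary) lastEq ⟩
    (pentSum m z + s * F (z - + P⁻)) + s * F (z - + P⁺)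
      ≡⟨ regroup (F z) (sumFrom1 (pentTerm z) m) s (F (z - + P⁻)) (F (z - + P⁺)) ⟩
    pentSum (suc m) z ∎
    where
    s = sgn (suc m)
    P⁻ = suc m ℕ.* (3 ℕ.* suc m ∸ 1)
    P⁺ = suc m ℕ.* (3 ℕ.* suc m ℕ.+ 1)
    last = shanksTerm (suc m) z (suc m)
    boundary : correction m z (suc m) - + 0 ≡ s * F (z - + P⁻)
    boundary = trans (shift-zero _)
      (cong (s *_) (trans (A-diag m _) (cong (λ k → F (z - + k)) (shanksExp-pent⁻ m))))
    lastEq : last ≡ s * F (z - + P⁺)
    lastEq = cong (s *_) (trans (A-diag (suc m) _) (cong (λ k → F (z - + k)) (shanksExp-pent⁺ m)))
    regroup : ∀ (f S s p q : ℤ) → (f + S + s * p) + s * q ≡ f + (S + s * (p + q))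
    regroup = solve-∀

partialProd : Seq → ℕ → ℕ → Seq
partialProd F m j = prodOp j (m ∸ j) F

partialProd-top : ∀ F m j → j ≤ m → ∀ w →
  partialProd F (suc m) j w ≡ oneMinus (2 ℕ.* suc m) (partialProd F m j) w
partialProd-top F m j j≤m w rewrite ℕP.+-∸-assoc 1 j≤m =
  trans (prodOp-last j (m ∸ j) F w)
        (cong (λ k → oneMinus (2 ℕ.* suc k) (prodOp j (m ∸ j) F) w) (ℕP.m+[n∸m]≡n j≤m))

partialProd-step : ∀ F m i → suc i ≤ m → ∀ w →
  partialProd F m i w ≡ oneMinus (2 ℕ.* suc i) (partialProd F m (suc i)) w
partialProd-step F (suc m) i (s≤s i≤m) w rewrite ℕP.+-∸-assoc 1 i≤m = refl

partialProd-diag : ∀ F m w → partialProd F m m w ≡ F w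
partialProd-diag F m w rewrite ℕP.n∸n≡0 m = refl

module PentagonalExpansion (F : Seq) where
  open Shanks F (partialProd F) (partialProd-top F) (partialProd-step F) (partialProd-diag F) public

  -- For coefficients of q^n with n ≤ m only the j = 0 term of Shanks' sum
  -- survives, so the pentagonal sum computes ∏_{k≤m} (1 - q^{2k}) F there.
  shanksSum-truncated : (∀ z → z ℤ.< + 0 → F z ≡ + 0) →
    ∀ m n → n ≤ m → shanksSum m (+ n) ≡ prodOp 0 m F (+ n)
  shanksSum-truncated F-neg m n n≤m = begin
    shanksSum m (+ n)                ≡⟨ Σ₀-head (shanksTerm m (+ n)) m vanish ⟩
    sgn 0 * prodOp 0 m F (+ n - + 0) ≡⟨ ℤP.*-identityˡ _ ⟩
    prodOp 0 m F (+ n - + 0)         ≡⟨ cong (prodOp 0 m F) (shift-zero (+ n)) ⟩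
    prodOp 0 m F (+ n)               ∎
    where
    vanish : ∀ i → suc i ≤ m → shanksTerm m (+ n) (suc i) ≡ + 0
    vanish i _ = trans
      (cong (sgn (suc i) *_) (prodOp-neg (suc i) (m ∸ suc i) F F-neg _
        (shift-< (ℕP.≤-<-trans n≤m (shanksExp-large m i)))))
      (ℤP.*-zeroʳ (sgn (suc i)))

pbarSeq : Seq
pbarSeq z = + pbarℤ z

pbarSeq-neg : ∀ z → z ℤ.< + 0 → pbarSeq z ≡ + 0
pbarSeq-neg (+ n)    (ℤ.+<+ ())
pbarSeq-neg -[1+ n ] _ = refl

pbarSeq-truncated : ∀ J n → n ≤ J → ∀ w → w ℤ.≤ + n → pbarSeq w ≡ opSeq J w
pbarSeq-truncated J n n≤J (+ m) (ℤ.+≤+ m≤n) = cong +_ (sym (opCount-stable J m (ℕP.≤-trans m≤n n≤J)))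
pbarSeq-truncated J n n≤J -[1+ k ] _        = refl

open PentagonalExpansion pbarSeq using (shanks; shanksSum; shanksSum-truncated)

theorem3p4 : (n : ℕ) → (J : ℕ) → n ≤ J →
    + pbar n + sumFrom1 (term n) J ≡ + pbard n
theorem3p4 n J n≤J = begin
  + pbar n + sumFrom1 (term n) J   ≡⟨ sym (shanks J (+ n)) ⟩
  shanksSum J (+ n)                ≡⟨ shanksSum-truncated pbarSeq-neg J n n≤J ⟩
  prodOp 0 J pbarSeq (+ n)         ≡⟨ prodOp-ext 0 J _ _ (+ n) (pbarSeq-truncated J n n≤J) (+ n) ℤP.≤-refl ⟩
  prodOp 0 J (opSeq J) (+ n)       ≡⟨ euler-product J (+ n) ⟩
  + pdCount J n                    ≡⟨ cong +_ (pdCount-stable J n n≤J) ⟩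
  + pbard n                        ∎
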